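{- For all $n\geq0$, $\Pi_n(13/2,\,123)$ is the set of partitions of $[n]$ that are layered matchings, and $\#\Pi_n(13/2,\,123)=F_n$.
   Context: For $n\ge 0$, $[n]=\{1,\dots,n\}$ and $\Pi_n$ is the set of set partitions of $[n]$ ($\Pi_0$ consists of the empty partition). A partition is written $B_1/B_2/\cdots/B_k$ with blocks in canonical order $\min B_1<\cdots<\min B_k$ and elements of each block listed increasingly. A partition is layered if it has the form $[1,i]/[i+1,j]/[j+1,k]/\cdots/[\ell+1,n]$, i.e. each block is a set of consecutive integers; it is a matching if every block has at most 2 elements. For $\pi\in\Pi_m$ and $\sigma\in\Pi_n$, $\sigma$ contains the pattern $\pi$ if there is $S\subseteq[n]$ with $\#S=m$ such that the restriction $\{B\cap S: B\in\sigma,\ B\cap S\neq\emptyset\}$, relabeled by the order-preserving bijection $S\to[m]$, equals $\pi$; otherwise $\sigma$ avoids $\pi$. $\Pi_n(R)$ is the set of $\sigma\in\Pi_n$ avoiding every pattern in $R$. $F_n$ denotes the Fibonacci numbers with $F_0=F_1=1$ and $F_n=F_{n-1}+F_{n-2}$. -}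

module Defs where

open import Data.Nat using (ℕ; zero; suc; _+_; _<_; _≤_; _≤?_)
open import Data.Nat.Properties using (_≟_)
open import Data.Product using (Σ; ∃; _×_; _,_)
open import Data.List using (List; []; _∷_; map; filter; length; concat; upTo)
open import Data.List.Relation.Unary.All using (All)
open import Data.List.Relation.Unary.Linked using (Linked)
open import Data.List.Relation.Unary.Unique.Propositional using (Unique)
open import Data.List.Membership.DecPropositional _≟_ using (_∈?_)
open import Data.List.Membership.Propositional using (_∈_)
open import Data.List.Relation.Binary.Permutation.Propositional using (_↭_)
open import Data.List.Relation.Binary.Sublist.Propositional using (_⊆_)
open import Relation.Binary.PropositionalEquality using (_≡_; _≢_)
open import Relation.Nullary using (¬_)
open import Function.Bundles using (_⇔_)

F : ℕ → ℕ
F zero = 1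
F (suc zero) = 1
F (suc (suc n)) = F (suc n) + F n

interval : ℕ → List ℕ
interval n = map suc (upTo n)

-- A partition is written as its list of blocks B₁/B₂/⋯/Bₖ,
-- each block a list of elements.
Blocks : Set
Blocks = List (List ℕ)

HeadLt : List ℕ → List ℕ → Set
HeadLt b c = ∃ λ x → ∃ λ y → ∃ λ bs → ∃ λ cs → (b ≡ x ∷ bs) × (c ≡ y ∷ cs) × (x < y)

-- σ is a set partition of [n], written in canonical form:
-- nonempty blocks, each listed increasingly, blocks ordered by their minima,
-- and every element of [n] occurs in exactly one block (disjoint cover).
IsSetPartition : ℕ → Blocks → Set
IsSetPartition n σ =
  All (λ b → b ≢ []) σ × All (Linked _<_) σ × Linked HeadLt σ × (concat σ ↭ interval n)

-- order-preserving relabelling S → [#S] : x ↦ #{ s ∈ S : s ≤ x }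
rank : List ℕ → ℕ → ℕ
rank S x = length (filter (_≤? x) S)

nonEmpty? : (b : List ℕ) → Relation.Nullary.Dec (b ≢ [])
nonEmpty? [] = Relation.Nullary.no (λ p → p Relation.Binary.PropositionalEquality.refl)
nonEmpty? (x ∷ b) = Relation.Nullary.yes (λ ())

-- { B ∩ S : B ∈ σ, B ∩ S ≠ ∅ } relabelled by the order-preserving bijection S → [#S]
restrict : List ℕ → Blocks → Blocks
restrict S σ = map (map (rank S)) (filter nonEmpty? (map (filter (_∈? S)) σ))

-- σ ∈ Π_n contains the pattern π ∈ Π_m: some S ⊆ [n] with #S = m whose
-- restriction equals π (as a set of blocks, i.e. up to reordering of blocks)
Contains : ℕ → Blocks → ℕ → Blocks → Set
Contains m π n σ = ∃ λ S → (S ⊆ interval n) × (length S ≡ m) × (restrict S σ ↭ π)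

Pattern : Set
Pattern = Σ ℕ (λ _ → Blocks)

Avoids : List Pattern → ℕ → Blocks → Set
Avoids R n σ = All (λ p → ¬ Contains (Data.Product.proj₁ p) (Data.Product.proj₂ p) n σ) R

InΠ : ℕ → List Pattern → Blocks → Set
InΠ n R σ = IsSetPartition n σ × Avoids R n σ

Layered : Blocks → Set
Layered σ = All (Linked (λ x y → y ≡ suc x)) σ

Matching : Blocks → Set
Matching σ = All (λ b → length b ≤ 2) σ

HasCard : (Blocks → Set) → ℕ → Set
HasCard P k = ∃ λ L → Unique L × (∀ σ → (σ ∈ L) ⇔ P σ) × (length L ≡ k)

p13/2 : Pattern
p13/2 = 3 , ((1 ∷ 3 ∷ []) ∷ (2 ∷ []) ∷ [])

p123 : Pattern
p123 = 3 , ((1 ∷ 2 ∷ 3 ∷ []) ∷ [])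

{-# OPTIONS --safe #-}
module Submission where

-- Three elements of one block restrict to 123, so avoiding 123 forces a matching.  In a matching,
-- a block {x, y} with y > x + 1 leaves x + 1 to another block, and {x, x + 1, y} restricts to 13/2.
-- Conversely, in a layered matching no block has an element strictly between two elements of another
-- block; rank is monotone, so this survives restriction, whereas in 13/2 the block {2} sits inside
-- {1, 3}.  A layered matching of [n] starts with {1} or {1, 2}, which gives the Fibonacci recursion.

open import Defs
open import Data.Bool using (true; false)
open import Data.Empty using (⊥; ⊥-elim)
open import Data.Nat using (ℕ; zero; suc; _+_; _<_; _≤_; z≤n; s≤s; z<s)
open import Data.Nat.Properties
open import Data.Product using (∃-syntax; _×_; _,_; proj₁; proj₂)
open import Data.Sum as Sum using (_⊎_; inj₁; inj₂)
open import Data.List using (List; []; _∷_; map; filter; length; concat; _++_; applyUpTo)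
open import Data.List.Properties
  using (map-upTo; length-++; length-map; length-filter; ∷-injectiveʳ; filter-accept; filter-reject; filter-none)
open import Data.List.Membership.Propositional using (_∈_)
open import Data.List.Membership.Propositional.Properties
open import Data.List.Membership.DecPropositional _≟_ using (_∈?_)
open import Data.List.Relation.Unary.All as All using (All; []; _∷_)
import Data.List.Relation.Unary.All.Properties as All
open import Data.List.Relation.Unary.Any using (here; there)
open import Data.List.Relation.Unary.AllPairs as AllPairs using (AllPairs; []; _∷_)
import Data.List.Relation.Unary.AllPairs.Properties as AllPairs
open import Data.List.Relation.Unary.Linked as Linked using (Linked; []; [-]; _∷_)
import Data.List.Relation.Unary.Linked.Properties as Linked
open import Data.List.Relation.Unary.Unique.Propositional using (Unique)
import Data.List.Relation.Unary.Unique.Propositional.Properties as Unique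
open import Data.List.Relation.Binary.Permutation.Propositional
  using (_↭_; ↭-refl; ↭-sym; ↭-trans; ↭-swap; ↭-reflexive; ↭⇒↭ₛ)
open import Data.List.Relation.Binary.Permutation.Propositional.Properties
  using (∈-resp-↭; All-resp-↭; drop-∷; ↭-length; ¬x∷xs↭[]; map⁺)
import Data.List.Relation.Binary.Permutation.Setoid.Properties as Perm
open import Data.List.Relation.Binary.Sublist.Propositional
  using (_⊆_; []; _∷_; _∷ʳ_; minimum; from∈; lookup; ⊆-refl)
import Data.List.Relation.Binary.Sublist.Propositional.Properties as Sublist
open import Function using (id; _∘_)
open import Function.Bundles using (_⇔_; mk⇔; Equivalence)
open import Function.Properties.Equivalence using () renaming (trans to ⇔-trans; sym to ⇔-sym)
open import Relation.Binary.PropositionalEquality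
  using (_≡_; _≢_; refl; sym; trans; cong; cong₂; subst; resp₂; module ≡-Reasoning)
open import Relation.Binary.PropositionalEquality.Properties using (setoid)
open import Relation.Nullary using (¬_; yes; no; does)
open import Relation.Nullary.Decidable using (dec-true; dec-false)
open import Relation.Unary using (Decidable)

intervalFrom : ℕ → ℕ → List ℕ
intervalFrom s zero    = []
intervalFrom s (suc k) = s ∷ intervalFrom (suc s) k

applyUpTo≡intervalFrom : ∀ {f : ℕ → ℕ} s k → (∀ i → f i ≡ s + i) → applyUpTo f k ≡ intervalFrom s k
applyUpTo≡intervalFrom s zero    f≗ = refl
applyUpTo≡intervalFrom s (suc k) f≗ =
  cong₂ _∷_ (trans (f≗ 0) (+-identityʳ s))
            (applyUpTo≡intervalFrom (suc s) k (λ i → trans (f≗ (suc i)) (+-suc s i)))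

interval≡intervalFrom : ∀ n → interval n ≡ intervalFrom 1 n
interval≡intervalFrom n = trans (map-upTo suc n) (applyUpTo≡intervalFrom 1 n (λ _ → refl))

∈-intervalFrom⁻ : ∀ {e} s k → e ∈ intervalFrom s k → s ≤ e × e < s + k
∈-intervalFrom⁻ s (suc k) (here refl) = ≤-refl , m<m+n s z<s
∈-intervalFrom⁻ {e} s (suc k) (there e∈) with ∈-intervalFrom⁻ (suc s) k e∈
... | s<e , e<s+k = <⇒≤ s<e , subst (e <_) (sym (+-suc s k)) e<s+k

∈-intervalFrom⁺ : ∀ {e} s k → s ≤ e → e < s + k → e ∈ intervalFrom s k
∈-intervalFrom⁺ {e} s zero    s≤e e<s+0 = ⊥-elim (≤⇒≯ s≤e (subst (e <_) (+-identityʳ s) e<s+0))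
∈-intervalFrom⁺ {e} s (suc k) s≤e e<s+k with m≤n⇒m<n∨m≡n s≤e
... | inj₂ refl = here refl
... | inj₁ s<e  = there (∈-intervalFrom⁺ (suc s) k s<e (subst (e <_) (+-suc s k) e<s+k))

intervalFrom-sorted : ∀ s k → AllPairs _<_ (intervalFrom s k)
intervalFrom-sorted s zero    = []
intervalFrom-sorted s (suc k) =
  All.tabulate (λ e∈ → proj₁ (∈-intervalFrom⁻ (suc s) k e∈)) ∷ intervalFrom-sorted (suc s) k

interval-sorted : ∀ n → AllPairs _<_ (interval n)
interval-sorted n = subst (AllPairs _<_) (sym (interval≡intervalFrom n)) (intervalFrom-sorted 1 n)

interval-convex : ∀ {n x y m} → x ∈ interval n → y ∈ interval n → x ≤ m → m ≤ y → m ∈ interval n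
interval-convex {n} x∈ y∈ x≤m m≤y rewrite interval≡intervalFrom n =
  ∈-intervalFrom⁺ 1 n (≤-trans (proj₁ (∈-intervalFrom⁻ 1 n x∈)) x≤m)
                      (≤-<-trans m≤y (proj₂ (∈-intervalFrom⁻ 1 n y∈)))

sorted⇒unique : ∀ {xs} → AllPairs _<_ xs → Unique xs
sorted⇒unique = AllPairs.map <⇒≢

∈-tail : ∀ {x y xs} → x < y → y ∈ x ∷ xs → y ∈ xs
∈-tail x<y (here refl) = ⊥-elim (<-irrefl refl x<y)
∈-tail _   (there y∈)  = y∈

sorted-⊆ : ∀ {S xs} → AllPairs _<_ S → AllPairs _<_ xs → All (_∈ xs) S → S ⊆ xs
sorted-⊆ {[]}    _ _ _ = minimum _
sorted-⊆ {a ∷ S} {x ∷ xs} (a<S ∷ S-sorted) (x<xs ∷ xs-sorted) (here refl ∷ S⊆) =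
  refl ∷ sorted-⊆ S-sorted xs-sorted (All.zipWith (λ (a<e , e∈) → ∈-tail a<e e∈) (a<S , S⊆))
sorted-⊆ {a ∷ S} {x ∷ xs} (a<S ∷ S-sorted) (x<xs ∷ xs-sorted) (there a∈xs ∷ S⊆) =
  x ∷ʳ sorted-⊆ (a<S ∷ S-sorted) xs-sorted (a∈xs ∷ All.zipWith (λ (a<e , e∈) → ∈-tail (<-trans x<a a<e) e∈) (a<S , S⊆))
  where x<a = All.lookup x<xs a∈xs

sorted₃-⊆-interval : ∀ {n x y z} → x < y → y < z → All (_∈ interval n) (x ∷ y ∷ z ∷ []) →
                     (x ∷ y ∷ z ∷ []) ⊆ interval n
sorted₃-⊆-interval {n} x<y y<z =
  sorted-⊆ ((x<y ∷ <-trans x<y y<z ∷ []) ∷ (y<z ∷ []) ∷ [] ∷ []) (interval-sorted n)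

unique-++⁻ʳ : ∀ xs {ys : List ℕ} → Unique (xs ++ ys) → Unique ys
unique-++⁻ʳ []       u       = u
unique-++⁻ʳ (x ∷ xs) (_ ∷ u) = unique-++⁻ʳ xs u

unique-++-disjoint : ∀ xs {ys : List ℕ} {e} → Unique (xs ++ ys) → e ∈ xs → e ∈ ys → ⊥
unique-++-disjoint (x ∷ xs) (x∉ ∷ _) (here refl) e∈ys = All.lookup x∉ (∈-++⁺ʳ xs e∈ys) refl
unique-++-disjoint (x ∷ xs) (_ ∷ u)  (there e∈)  e∈ys = unique-++-disjoint xs u e∈ e∈ys

same-block : ∀ {σ : Blocks} {b c e} → Unique (concat σ) → b ∈ σ → c ∈ σ → e ∈ b → e ∈ c → b ≡ c
same-block {d ∷ σ} u (here refl) (here refl) _   _   = refl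
same-block {d ∷ σ} u (here refl) (there c∈)  e∈b e∈c = ⊥-elim (unique-++-disjoint d u e∈b (∈-concat⁺′ e∈c c∈))
same-block {d ∷ σ} u (there b∈)  (here refl) e∈b e∈c = ⊥-elim (unique-++-disjoint d u e∈c (∈-concat⁺′ e∈b b∈))
same-block {d ∷ σ} u (there b∈)  (there c∈)  e∈b e∈c = same-block (unique-++⁻ʳ d u) b∈ c∈ e∈b e∈c

IsPartitionOf : List ℕ → Blocks → Set
IsPartitionOf X σ = All (λ b → b ≢ []) σ × All (Linked _<_) σ × Linked HeadLt σ × (concat σ ↭ X)

∈-ground : ∀ {X σ b e} → IsPartitionOf X σ → b ∈ σ → e ∈ b → e ∈ X
∈-ground (_ , _ , _ , cover) b∈ e∈b = ∈-resp-↭ cover (∈-concat⁺′ e∈b b∈)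

partition-unique : ∀ {X σ} → IsPartitionOf X σ → Unique X → Unique (concat σ)
partition-unique (_ , _ , _ , cover) = Perm.Unique-resp-↭ (setoid ℕ) (↭⇒↭ₛ (↭-sym cover))

setPartition-unique : ∀ {n σ} → IsSetPartition n σ → Unique (concat σ)
setPartition-unique {n} p = partition-unique p (sorted⇒unique (interval-sorted n))

block-unique : ∀ {X σ b} → IsPartitionOf X σ → b ∈ σ → Unique b
block-unique (_ , sorted , _) b∈ = sorted⇒unique (Linked.Linked⇒AllPairs <-trans (All.lookup sorted b∈))

↭-drop-prefix : ∀ (b : List ℕ) {xs ys} → b ++ xs ↭ b ++ ys → xs ↭ ys
↭-drop-prefix []      p = p
↭-drop-prefix (x ∷ b) p = ↭-drop-prefix b (drop-∷ p)

partition-tail : ∀ {X b σ} → IsPartitionOf (b ++ X) (b ∷ σ) → IsPartitionOf X σ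
partition-tail {b = b} (_ ∷ nonempty , _ ∷ sorted , heads , cover) =
  nonempty , sorted , Linked.tail heads , ↭-drop-prefix b cover

linked-head-≤ : ∀ {x xs} → Linked _<_ (x ∷ xs) → All (x ≤_) (x ∷ xs)
linked-head-≤ [-]          = ≤-refl ∷ []
linked-head-≤ (x<y ∷ rest) = ≤-refl ∷ All.map <⇒≤ (Linked.Linked⇒All <-trans x<y rest)

head-≤-concat : ∀ {x bs σ} → All (Linked _<_) ((x ∷ bs) ∷ σ) → Linked HeadLt ((x ∷ bs) ∷ σ) →
                All (x ≤_) (concat ((x ∷ bs) ∷ σ))
head-≤-concat {σ = []}    (sorted ∷ []) _ = All.++⁺ (linked-head-≤ sorted) []
head-≤-concat {σ = _ ∷ _} (sorted ∷ sorteds) ((_ , _ , _ , _ , refl , refl , x<y) ∷ heads) =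
  All.++⁺ (linked-head-≤ sorted) (All.map (≤-trans (<⇒≤ x<y)) (head-≤-concat sorteds heads))

head-block-starts : ∀ {s n x bs σ} → IsPartitionOf (intervalFrom s n) ((x ∷ bs) ∷ σ) → x ≡ s
head-block-starts {s} {n} (_ , sorted , heads , cover) = ≤-antisym x≤s s≤x
  where
  x-bounds = ∈-intervalFrom⁻ s n (∈-resp-↭ cover (here refl))
  s≤x = proj₁ x-bounds
  s∈ = ∈-resp-↭ (↭-sym cover) (∈-intervalFrom⁺ s n ≤-refl (≤-<-trans s≤x (proj₂ x-bounds)))
  x≤s = All.lookup (head-≤-concat sorted heads) s∈

-- Layered matchings

-- LayeredMatching s n σ: σ is a layered matching of [s, s + n).
data LayeredMatching : ℕ → ℕ → Blocks → Set where
  done   : ∀ {s} → LayeredMatching s 0 []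
  single : ∀ {s n σ} → LayeredMatching (suc s) n σ → LayeredMatching s (suc n) ((s ∷ []) ∷ σ)
  pair   : ∀ {s n σ} → LayeredMatching (suc (suc s)) n σ → LayeredMatching s (suc (suc n)) ((s ∷ suc s ∷ []) ∷ σ)

layeredMatchings : ℕ → ℕ → List Blocks
layeredMatchings s zero          = [] ∷ []
layeredMatchings s (suc zero)    = ((s ∷ []) ∷ []) ∷ []
layeredMatchings s (suc (suc n)) =
  map ((s ∷ []) ∷_) (layeredMatchings (suc s) (suc n)) ++
  map ((s ∷ suc s ∷ []) ∷_) (layeredMatchings (suc (suc s)) n)

∈-layeredMatchings⁻ : ∀ s n {σ} → σ ∈ layeredMatchings s n → LayeredMatching s n σ
∈-layeredMatchings⁻ s zero          (here refl)         = done
∈-layeredMatchings⁻ s (suc zero)    (here refl)         = single done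
∈-layeredMatchings⁻ s (suc (suc n)) σ∈ with ∈-++⁻ (map ((s ∷ []) ∷_) (layeredMatchings (suc s) (suc n))) σ∈
... | inj₁ σ∈₁ with _ , τ∈ , refl ← ∈-map⁻ _ σ∈₁ = single (∈-layeredMatchings⁻ (suc s) (suc n) τ∈)
... | inj₂ σ∈₂ with _ , τ∈ , refl ← ∈-map⁻ _ σ∈₂ = pair (∈-layeredMatchings⁻ (suc (suc s)) n τ∈)

∈-layeredMatchings⁺ : ∀ {s n σ} → LayeredMatching s n σ → σ ∈ layeredMatchings s n
∈-layeredMatchings⁺ done                     = here refl
∈-layeredMatchings⁺ (single {n = zero} done) = here refl
∈-layeredMatchings⁺ (single {n = suc _} l)   = ∈-++⁺ˡ (∈-map⁺ _ (∈-layeredMatchings⁺ l))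
∈-layeredMatchings⁺ (pair l)                 = ∈-++⁺ʳ _ (∈-map⁺ _ (∈-layeredMatchings⁺ l))

∈-layeredMatchings : ∀ s n {σ} → σ ∈ layeredMatchings s n ⇔ LayeredMatching s n σ
∈-layeredMatchings s n = mk⇔ (∈-layeredMatchings⁻ s n) ∈-layeredMatchings⁺

layeredMatchings-unique : ∀ s n → Unique (layeredMatchings s n)
layeredMatchings-unique s zero          = [] ∷ []
layeredMatchings-unique s (suc zero)    = [] ∷ []
layeredMatchings-unique s (suc (suc n)) =
  Unique.++⁺ (Unique.map⁺ ∷-injectiveʳ (layeredMatchings-unique (suc s) (suc n)))
             (Unique.map⁺ ∷-injectiveʳ (layeredMatchings-unique (suc (suc s)) n))
             first-blocks-differ
  where
  first-blocks-differ : ∀ {σ} → σ ∈ map ((s ∷ []) ∷_) (layeredMatchings (suc s) (suc n)) ×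
                                σ ∈ map ((s ∷ suc s ∷ []) ∷_) (layeredMatchings (suc (suc s)) n) → ⊥
  first-blocks-differ (σ∈₁ , σ∈₂) with _ , _ , refl ← ∈-map⁻ _ σ∈₁ with _ , _ , () ← ∈-map⁻ _ σ∈₂

length-layeredMatchings : ∀ s n → length (layeredMatchings s n) ≡ F n
length-layeredMatchings s zero          = refl
length-layeredMatchings s (suc zero)    = refl
length-layeredMatchings s (suc (suc n)) = begin
  length (map _ singles ++ map _ pairs)         ≡⟨ length-++ (map _ singles) ⟩
  length (map _ singles) + length (map _ pairs) ≡⟨ cong₂ _+_ (length-map _ singles) (length-map _ pairs) ⟩
  length singles + length pairs                 ≡⟨ cong₂ _+_ (length-layeredMatchings (suc s) (suc n))
                                                                 (length-layeredMatchings (suc (suc s)) n) ⟩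
  F (suc n) + F n                               ∎
  where
  open ≡-Reasoning
  singles = layeredMatchings (suc s) (suc n)
  pairs   = layeredMatchings (suc (suc s)) n

concat-layeredMatching : ∀ {s n σ} → LayeredMatching s n σ → concat σ ≡ intervalFrom s n
concat-layeredMatching done       = refl
concat-layeredMatching (single l) = cong (_ ∷_) (concat-layeredMatching l)
concat-layeredMatching (pair l)   = cong (λ t → _ ∷ _ ∷ t) (concat-layeredMatching l)

layeredMatching-heads : ∀ {t n σ x bs} → LayeredMatching t n σ → x < t → Linked HeadLt ((x ∷ bs) ∷ σ)
layeredMatching-heads done       _   = [-]
layeredMatching-heads (single l) x<t = (_ , _ , _ , _ , refl , refl , x<t) ∷ layeredMatching-heads l (n<1+n _)
layeredMatching-heads (pair l)   x<t =
  (_ , _ , _ , _ , refl , refl , x<t) ∷ layeredMatching-heads l (<-trans (n<1+n _) (n<1+n _))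

layeredMatching⇒partition : ∀ {s n σ} → LayeredMatching s n σ → IsPartitionOf (intervalFrom s n) σ
layeredMatching⇒partition l = nonempty l , sorted l , heads l , ↭-reflexive (concat-layeredMatching l)
  where
  nonempty : ∀ {s n σ} → LayeredMatching s n σ → All (λ b → b ≢ []) σ
  nonempty done       = []
  nonempty (single l) = (λ ()) ∷ nonempty l
  nonempty (pair l)   = (λ ()) ∷ nonempty l
  sorted : ∀ {s n σ} → LayeredMatching s n σ → All (Linked _<_) σ
  sorted done       = []
  sorted (single l) = [-] ∷ sorted l
  sorted (pair l)   = (n<1+n _ ∷ [-]) ∷ sorted l
  heads : ∀ {s n σ} → LayeredMatching s n σ → Linked HeadLt σ
  heads done       = []
  heads (single l) = layeredMatching-heads l (n<1+n _)
  heads (pair l)   = layeredMatching-heads l (<-trans (n<1+n _) (n<1+n _))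

layeredMatching⇒layered : ∀ {s n σ} → LayeredMatching s n σ → Layered σ
layeredMatching⇒layered done       = []
layeredMatching⇒layered (single l) = [-] ∷ layeredMatching⇒layered l
layeredMatching⇒layered (pair l)   = (refl ∷ [-]) ∷ layeredMatching⇒layered l

layeredMatching⇒matching : ∀ {s n σ} → LayeredMatching s n σ → Matching σ
layeredMatching⇒matching done       = []
layeredMatching⇒matching (single l) = s≤s z≤n ∷ layeredMatching⇒matching l
layeredMatching⇒matching (pair l)   = s≤s (s≤s z≤n) ∷ layeredMatching⇒matching l

partition⇒layeredMatching : ∀ {s n σ} → IsPartitionOf (intervalFrom s n) σ → Layered σ → Matching σ →
                            LayeredMatching s n σ
partition⇒layeredMatching {n = zero}  {[]} _ _ _ = done
partition⇒layeredMatching {n = suc _} {[]} (_ , _ , _ , cover) _ _ = ⊥-elim (¬x∷xs↭[] (↭-sym cover))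
partition⇒layeredMatching {σ = [] ∷ _} (nonempty ∷ _ , _) _ _ = ⊥-elim (nonempty refl)
partition⇒layeredMatching {n = zero} {(_ ∷ _) ∷ _} (_ , _ , _ , cover) _ _ = ⊥-elim (¬x∷xs↭[] cover)
partition⇒layeredMatching {σ = (_ ∷ _ ∷ _ ∷ _) ∷ _} _ _ (s≤s (s≤s ()) ∷ _)
partition⇒layeredMatching {n = suc _} {(_ ∷ []) ∷ _} p (_ ∷ layered) (_ ∷ matching)
  with refl ← head-block-starts p = single (partition⇒layeredMatching (partition-tail p) layered matching)
partition⇒layeredMatching {n = suc zero} {(_ ∷ _ ∷ []) ∷ _} (_ , _ , _ , cover) _ _ with () ← ↭-length cover
partition⇒layeredMatching {n = suc (suc _)} {(_ ∷ _ ∷ []) ∷ _} p ((refl ∷ [-]) ∷ layered) (_ ∷ matching)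
  with refl ← head-block-starts p = pair (partition⇒layeredMatching (partition-tail p) layered matching)

layeredMatching⇔ : ∀ n σ → LayeredMatching 1 n σ ⇔ (IsSetPartition n σ × Layered σ × Matching σ)
layeredMatching⇔ n σ rewrite interval≡intervalFrom n = mk⇔
  (λ l → layeredMatching⇒partition l , layeredMatching⇒layered l , layeredMatching⇒matching l)
  (λ (p , layered , matching) → partition⇒layeredMatching p layered matching)

-- Properties inherited by restrictions

rank-mono : ∀ S {u v} → u ≤ v → rank S u ≤ rank S v
rank-mono S {u} {v} u≤v =
  Sublist.length-mono-≤ (Sublist.filter⁺ (_≤? u) (_≤? v) (λ { refl a≤u → ≤-trans a≤u u≤v }) (⊆-refl {x = S}))

rank-cancel-< : ∀ S {u v} → rank S u < rank S v → u < v
rank-cancel-< S ru<rv = ≰⇒> (λ v≤u → <⇒≱ ru<rv (rank-mono S v≤u))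

-- rank S is only weakly monotone: it reflects < but need not preserve it.  Hence the invariant
-- carried to restrictions is the absence of gap entries.
_EntersGapOf_ : List ℕ → List ℕ → Set
C EntersGapOf B = ∃[ a ] ∃[ b ] ∃[ c ] (a ∈ B × b ∈ C × c ∈ B × a < b × b < c)

Apart : List ℕ → List ℕ → Set
Apart B C = ¬ (C EntersGapOf B) × ¬ (B EntersGapOf C)

PairwiseApart : Blocks → Set
PairwiseApart = AllPairs Apart

entersGap-map⁻ : ∀ {f : ℕ → ℕ} {B C} → (∀ {u v} → f u < f v → u < v) →
                 map f C EntersGapOf map f B → C EntersGapOf B
entersGap-map⁻ {f} f-cancel (_ , _ , _ , a∈ , b∈ , c∈ , a<b , b<c)
  with a , a∈′ , refl ← ∈-map⁻ f a∈ | b , b∈′ , refl ← ∈-map⁻ f b∈ | c , c∈′ , refl ← ∈-map⁻ f c∈ =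
  a , b , c , a∈′ , b∈′ , c∈′ , f-cancel a<b , f-cancel b<c

entersGap-filter⁻ : ∀ S {B C} → filter (_∈? S) C EntersGapOf filter (_∈? S) B → C EntersGapOf B
entersGap-filter⁻ S (a , b , c , a∈ , b∈ , c∈ , a<b , b<c) =
  a , b , c , unfilter a∈ , unfilter b∈ , unfilter c∈ , a<b , b<c
  where
  unfilter : ∀ {e xs} → e ∈ filter (_∈? S) xs → e ∈ xs
  unfilter e∈ = proj₁ (∈-filter⁻ (_∈? S) e∈)

apart-restrict : ∀ S {B C} → Apart B C →
                 Apart (map (rank S) (filter (_∈? S) B)) (map (rank S) (filter (_∈? S) C))
apart-restrict S (¬C⊏B , ¬B⊏C) = ¬C⊏B ∘ reflect , ¬B⊏C ∘ reflect
  where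
  reflect : ∀ {B C} → map (rank S) (filter (_∈? S) C) EntersGapOf map (rank S) (filter (_∈? S) B) →
            C EntersGapOf B
  reflect = entersGap-filter⁻ S ∘ entersGap-map⁻ (rank-cancel-< S)

pairwiseApart-restrict : ∀ S {σ} → PairwiseApart σ → PairwiseApart (restrict S σ)
pairwiseApart-restrict S apart =
  AllPairs.map⁺ (AllPairs.filter⁺ nonEmpty? (AllPairs.map⁺ (AllPairs.map (apart-restrict S) apart)))

pairwiseApart-↭ : ∀ {σ τ} → σ ↭ τ → PairwiseApart σ → PairwiseApart τ
pairwiseApart-↭ p = Perm.AllPairs-resp-↭ (setoid (List ℕ)) (λ (x , y) → y , x) (resp₂ Apart) (↭⇒↭ₛ p)

pairwiseApart⇒avoids : ∀ {m π n σ} → PairwiseApart σ → ¬ PairwiseApart π → ¬ Contains m π n σ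
pairwiseApart⇒avoids apart ¬apart (S , _ , _ , p) = ¬apart (pairwiseApart-↭ p (pairwiseApart-restrict S apart))

matching-restrict : ∀ S {σ} → Matching σ → Matching (restrict S σ)
matching-restrict S matching =
  All.map⁺ (All.filter⁺ nonEmpty? (All.map⁺ (All.map (λ {b} → shrink {b}) matching)))
  where
  shrink : ∀ {b} → length b ≤ 2 → length (map (rank S) (filter (_∈? S) b)) ≤ 2
  shrink {b} |b|≤2 =
    ≤-trans (≤-reflexive (length-map (rank S) (filter (_∈? S) b))) (≤-trans (length-filter (_∈? S) b) |b|≤2)

matching⇒avoids : ∀ {m π n σ} → Matching σ → ¬ Matching π → ¬ Contains m π n σ
matching⇒avoids matching ¬matching (S , _ , _ , p) = ¬matching (All-resp-↭ p (matching-restrict S matching))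

apart-threshold : ∀ {t B C} → All (_≤ t) B → All (t <_) C → Apart B C
apart-threshold B≤t t<C =
  (λ (_ , b , c , _ , b∈C , c∈B , _ , b<c) → <-asym b<c (≤-<-trans (All.lookup B≤t c∈B) (All.lookup t<C b∈C))) ,
  (λ (a , b , _ , a∈C , b∈B , _ , a<b , _) → <-asym a<b (≤-<-trans (All.lookup B≤t b∈B) (All.lookup t<C a∈C)))

layeredMatching-lowerBound : ∀ {s n σ} → LayeredMatching s n σ → All (All (s ≤_)) σ
layeredMatching-lowerBound {s} {n} l = All.tabulate (λ c∈ → All.tabulate (λ e∈c →
  proj₁ (∈-intervalFrom⁻ s n (subst (_ ∈_) (concat-layeredMatching l) (∈-concat⁺′ e∈c c∈)))))

layeredMatching⇒pairwiseApart : ∀ {s n σ} → LayeredMatching s n σ → PairwiseApart σ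
layeredMatching⇒pairwiseApart done       = []
layeredMatching⇒pairwiseApart (single l) =
  All.map (apart-threshold (≤-refl ∷ [])) (layeredMatching-lowerBound l) ∷
  layeredMatching⇒pairwiseApart l
layeredMatching⇒pairwiseApart (pair l)   =
  All.map (apart-threshold (n≤1+n _ ∷ ≤-refl ∷ [])) (layeredMatching-lowerBound l) ∷
  layeredMatching⇒pairwiseApart l

-- Computing restrictions

-- restrict S σ unfolds to map (map (rank S)) (trace S σ).
trace : List ℕ → Blocks → Blocks
trace S σ = filter nonEmpty? (map (filter (_∈? S)) σ)

concat-⊆ : ∀ {τ σ : Blocks} {e} → τ ⊆ σ → e ∈ concat τ → e ∈ concat σ
concat-⊆ {τ} τ⊆σ e∈ with c , e∈c , c∈τ ← ∈-concat⁻′ τ e∈ = ∈-concat⁺′ e∈c (lookup τ⊆σ c∈τ)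

filter-∷-cong : ∀ {A : Set} {P : A → Set} (P? : Decidable P) {x xs ys} →
                filter P? xs ≡ filter P? ys → filter P? (x ∷ xs) ≡ filter P? (x ∷ ys)
filter-∷-cong P? {x} eq with does (P? x)
... | true  = cong (x ∷_) eq
... | false = eq

trace-⊆ : ∀ {S σ τ} → Unique (concat σ) → τ ⊆ σ → (∀ {e} → e ∈ S → e ∈ concat σ → e ∈ concat τ) →
          trace S σ ≡ trace S τ
trace-⊆ _ [] _ = refl
trace-⊆ {S} {d ∷ σ} u (_ ∷ʳ τ⊆σ) S⊆τ =
  trans (filter-reject nonEmpty? (λ ne → ne (filter-none (_∈? S) (All.tabulate d∩S≡∅))))
        (trace-⊆ (unique-++⁻ʳ d u) τ⊆σ (λ e∈S e∈σ → S⊆τ e∈S (∈-++⁺ʳ d e∈σ)))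
  where
  d∩S≡∅ : ∀ {e} → e ∈ d → ¬ e ∈ S
  d∩S≡∅ e∈d e∈S = unique-++-disjoint d u e∈d (concat-⊆ τ⊆σ (S⊆τ e∈S (∈-++⁺ˡ e∈d)))
trace-⊆ {S} {d ∷ σ} {d ∷ τ} u (refl ∷ τ⊆σ) S⊆τ =
  filter-∷-cong nonEmpty? {x = filter (_∈? S) d} (trace-⊆ (unique-++⁻ʳ d u) τ⊆σ S⊆τ′)
  where
  S⊆τ′ : ∀ {e} → e ∈ S → e ∈ concat σ → e ∈ concat τ
  S⊆τ′ e∈S e∈σ with ∈-++⁻ d (S⊆τ e∈S (∈-++⁺ʳ d e∈σ))
  ... | inj₁ e∈d = ⊥-elim (unique-++-disjoint d u e∈d e∈σ)
  ... | inj₂ e∈τ = e∈τ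

trace-∷ : ∀ S b σ {x xs} → filter (_∈? S) b ≡ x ∷ xs → trace S (b ∷ σ) ≡ (x ∷ xs) ∷ trace S σ
trace-∷ S b σ eq rewrite eq = refl

filter-∈?-exact : ∀ {S d T} → Unique d → T ⊆ d → All (_∈ S) T → (∀ {e} → e ∈ d → e ∈ S → e ∈ T) →
                  filter (_∈? S) d ≡ T
filter-∈?-exact _ [] _ _ = refl
filter-∈?-exact {S} (x∉d ∷ d-unique) (x ∷ʳ T⊆d) T⊆S S∩d⊆T =
  trans (filter-reject (_∈? S) x∉S) (filter-∈?-exact d-unique T⊆d T⊆S (λ e∈d → S∩d⊆T (there e∈d)))
  where
  x∉S : ¬ x ∈ S
  x∉S x∈S = All.lookup x∉d (lookup T⊆d (S∩d⊆T (here refl) x∈S)) refl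
filter-∈?-exact {S} {x ∷ d} {x ∷ T} (x∉d ∷ d-unique) (refl ∷ T⊆d) (x∈S ∷ T⊆S) S∩d⊆T =
  trans (filter-accept (_∈? S) x∈S) (cong (x ∷_) (filter-∈?-exact d-unique T⊆d T⊆S S∩d⊆T′))
  where
  S∩d⊆T′ : ∀ {e} → e ∈ d → e ∈ S → e ∈ T
  S∩d⊆T′ e∈d e∈S with S∩d⊆T (there e∈d) e∈S
  ... | here refl = ⊥-elim (All.lookup x∉d e∈d refl)
  ... | there e∈T = e∈T

pair-⊆ : ∀ {σ : Blocks} {b c} → b ∈ σ → c ∈ σ → b ≢ c → (b ∷ c ∷ []) ⊆ σ ⊎ (c ∷ b ∷ []) ⊆ σ
pair-⊆         (here refl) (here refl) b≢c = ⊥-elim (b≢c refl)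
pair-⊆         (here refl) (there c∈)  _   = inj₁ (refl ∷ from∈ c∈)
pair-⊆         (there b∈)  (here refl) _   = inj₂ (refl ∷ from∈ b∈)
pair-⊆ {d ∷ _} (there b∈)  (there c∈)  b≢c = Sum.map (d ∷ʳ_) (d ∷ʳ_) (pair-⊆ b∈ c∈ b≢c)

∈-concat-pair : ∀ {b c : List ℕ} {e} → e ∈ b ⊎ e ∈ c → e ∈ concat (b ∷ c ∷ [])
∈-concat-pair     (inj₁ e∈b) = ∈-++⁺ˡ e∈b
∈-concat-pair {b} (inj₂ e∈c) = ∈-++⁺ʳ b (∈-++⁺ˡ e∈c)

trace-one-block : ∀ {S σ b x xs} → Unique (concat σ) → b ∈ σ → (∀ {e} → e ∈ S → e ∈ b) →
                  filter (_∈? S) b ≡ x ∷ xs → trace S σ ≡ (x ∷ xs) ∷ []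
trace-one-block {S} {b = b} u b∈ S⊆b b∩S =
  trans (trace-⊆ u (from∈ b∈) (λ e∈S _ → ∈-++⁺ˡ (S⊆b e∈S))) (trace-∷ S b [] b∩S)

trace-two-blocks : ∀ {S σ b c x xs y ys} → Unique (concat σ) → b ∈ σ → c ∈ σ → b ≢ c →
                   (∀ {e} → e ∈ S → e ∈ b ⊎ e ∈ c) → filter (_∈? S) b ≡ x ∷ xs → filter (_∈? S) c ≡ y ∷ ys →
                   trace S σ ↭ (x ∷ xs) ∷ (y ∷ ys) ∷ []
trace-two-blocks {S} {σ} {b} {c} {x} {xs} {y} {ys} u b∈ c∈ b≢c S⊆b∪c b∩S c∩S with pair-⊆ b∈ c∈ b≢c
... | inj₁ bc⊆σ = ↭-reflexive (begin
  trace S σ                   ≡⟨ trace-⊆ u bc⊆σ (λ e∈S _ → ∈-concat-pair (S⊆b∪c e∈S)) ⟩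
  trace S (b ∷ c ∷ [])        ≡⟨ trace-∷ S b (c ∷ []) b∩S ⟩
  (x ∷ xs) ∷ trace S (c ∷ []) ≡⟨ cong ((x ∷ xs) ∷_) (trace-∷ S c [] c∩S) ⟩
  (x ∷ xs) ∷ (y ∷ ys) ∷ []    ∎)
  where open ≡-Reasoning
... | inj₂ cb⊆σ = ↭-trans (↭-reflexive (begin
  trace S σ                   ≡⟨ trace-⊆ u cb⊆σ (λ e∈S _ → ∈-concat-pair (Sum.swap (S⊆b∪c e∈S))) ⟩
  trace S (c ∷ b ∷ [])        ≡⟨ trace-∷ S c (b ∷ []) c∩S ⟩
  (y ∷ ys) ∷ trace S (b ∷ []) ≡⟨ cong ((y ∷ ys) ∷_) (trace-∷ S b [] b∩S) ⟩
  (y ∷ ys) ∷ (x ∷ xs) ∷ []    ∎)) (↭-swap _ _ ↭-refl)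
  where open ≡-Reasoning

rank-sorted₃ : ∀ {x y z} → x < y → y < z →
               rank (x ∷ y ∷ z ∷ []) x ≡ 1 × rank (x ∷ y ∷ z ∷ []) y ≡ 2 × rank (x ∷ y ∷ z ∷ []) z ≡ 3
rank-sorted₃ {x} {y} {z} x<y y<z
  rewrite dec-true (x ≤? x) ≤-refl    | dec-false (y ≤? x) (<⇒≱ x<y) | dec-false (z ≤? x) (<⇒≱ (<-trans x<y y<z))
        | dec-true (x ≤? y) (<⇒≤ x<y) | dec-true  (y ≤? y) ≤-refl    | dec-false (z ≤? y) (<⇒≱ y<z)
        | dec-true (x ≤? z) (<⇒≤ (<-trans x<y y<z)) | dec-true (y ≤? z) (<⇒≤ y<z) | dec-true (z ≤? z) ≤-refl
        = refl , refl , refl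

big-block⇒contains-123 : ∀ {n σ x y z r} → IsSetPartition n σ → (x ∷ y ∷ z ∷ r) ∈ σ →
                         Contains 3 ((1 ∷ 2 ∷ 3 ∷ []) ∷ []) n σ
big-block⇒contains-123 {n} {σ} {x} {y} {z} {r} p@(_ , sorted , _) b∈ =
  S , sorted₃-⊆-interval x<y y<z (All.tabulate (∈-ground p b∈ ∘ lookup S⊆b)) , refl , ↭-reflexive restrict≡
  where
  b-sorted = All.lookup sorted b∈
  x<y = Linked.head b-sorted
  y<z = Linked.head (Linked.tail b-sorted)
  S = x ∷ y ∷ z ∷ []
  U = setPartition-unique p
  S⊆b : S ⊆ x ∷ y ∷ z ∷ r
  S⊆b = refl ∷ refl ∷ refl ∷ minimum r
  b∩S : filter (_∈? S) (x ∷ y ∷ z ∷ r) ≡ S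
  b∩S = filter-∈?-exact (block-unique p b∈) S⊆b (All.tabulate id) (λ _ e∈S → e∈S)
  restrict≡ : restrict S σ ≡ (1 ∷ 2 ∷ 3 ∷ []) ∷ []
  restrict≡ = let rx , ry , rz = rank-sorted₃ x<y y<z in begin
    map (map (rank S)) (trace S σ) ≡⟨ cong (map (map (rank S))) (trace-one-block U b∈ (lookup S⊆b) b∩S) ⟩
    map (rank S) S ∷ []            ≡⟨ cong (_∷ []) (cong₂ _∷_ rx (cong₂ _∷_ ry (cong (_∷ []) rz))) ⟩
    (1 ∷ 2 ∷ 3 ∷ []) ∷ []          ∎
    where open ≡-Reasoning

gap-block⇒contains-13/2 : ∀ {n σ x y} → IsSetPartition n σ → (x ∷ y ∷ []) ∈ σ → suc x < y →
                          Contains 3 ((1 ∷ 3 ∷ []) ∷ (2 ∷ []) ∷ []) n σ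
gap-block⇒contains-13/2 {n} {σ} {x} {y} p@(_ , _ , _ , cover) b∈ x+1<y =
  S , sorted₃-⊆-interval (n<1+n x) x+1<y (x∈ ∷ m∈ ∷ y∈ ∷ []) , refl , restrict↭
  where
  b = x ∷ y ∷ []
  x∈ = ∈-ground p b∈ (here refl)
  y∈ = ∈-ground p b∈ (there (here refl))
  m∈ = interval-convex x∈ y∈ (n≤1+n x) (<⇒≤ x+1<y)
  S = x ∷ suc x ∷ y ∷ []
  U = setPartition-unique p
  c-of-m = ∈-concat⁻′ σ (∈-resp-↭ (↭-sym cover) m∈)
  c = proj₁ c-of-m
  m∈c = proj₁ (proj₂ c-of-m)
  c∈ = proj₂ (proj₂ c-of-m)
  b≢c : b ≢ c
  b≢c b≡c with subst (suc x ∈_) (sym b≡c) m∈c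
  ... | here x+1≡x         = <-irrefl (sym x+1≡x) (n<1+n x)
  ... | there (here x+1≡y) = <-irrefl x+1≡y x+1<y
  b∩S : filter (_∈? S) b ≡ b
  b∩S = filter-∈?-exact (block-unique p b∈) ⊆-refl (here refl ∷ there (there (here refl)) ∷ []) (λ e∈b _ → e∈b)
  c∩S : filter (_∈? S) c ≡ suc x ∷ []
  c∩S = filter-∈?-exact (block-unique p c∈) (from∈ m∈c) (there (here refl) ∷ []) only-m
    where
    only-m : ∀ {e} → e ∈ c → e ∈ S → e ∈ suc x ∷ []
    only-m e∈c (here refl)                 = ⊥-elim (b≢c (same-block U b∈ c∈ (here refl) e∈c))
    only-m e∈c (there (here refl))         = here refl
    only-m e∈c (there (there (here refl))) = ⊥-elim (b≢c (same-block U b∈ c∈ (there (here refl)) e∈c))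
  S⊆b∪c : ∀ {e} → e ∈ S → e ∈ b ⊎ e ∈ c
  S⊆b∪c (here refl)                 = inj₁ (here refl)
  S⊆b∪c (there (here refl))         = inj₂ m∈c
  S⊆b∪c (there (there (here refl))) = inj₁ (there (here refl))
  restrict↭ : restrict S σ ↭ (1 ∷ 3 ∷ []) ∷ (2 ∷ []) ∷ []
  restrict↭ = let rx , rm , ry = rank-sorted₃ (n<1+n x) x+1<y in
    ↭-trans (map⁺ (map (rank S)) (trace-two-blocks U b∈ c∈ b≢c S⊆b∪c b∩S c∩S))
            (↭-reflexive (cong₂ (λ B C → B ∷ C ∷ []) (cong₂ _∷_ rx (cong (_∷ []) ry)) (cong (_∷ []) rm)))

avoids-123⇒matching : ∀ {n σ} → IsSetPartition n σ → ¬ Contains 3 ((1 ∷ 2 ∷ 3 ∷ []) ∷ []) n σ → Matching σ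
avoids-123⇒matching {σ = σ} p avoids = All.tabulate at-most-two
  where
  at-most-two : ∀ {b} → b ∈ σ → length b ≤ 2
  at-most-two {[]}              _  = z≤n
  at-most-two {_ ∷ []}          _  = s≤s z≤n
  at-most-two {_ ∷ _ ∷ []}      _  = s≤s (s≤s z≤n)
  at-most-two {_ ∷ _ ∷ _ ∷ _}   b∈ = ⊥-elim (avoids (big-block⇒contains-123 p b∈))

avoids-13/2⇒layered : ∀ {n σ} → IsSetPartition n σ → Matching σ →
                      ¬ Contains 3 ((1 ∷ 3 ∷ []) ∷ (2 ∷ []) ∷ []) n σ → Layered σ
avoids-13/2⇒layered {σ = σ} p@(_ , sorted , _) matching avoids = All.tabulate consecutive
  where
  consecutive : ∀ {b} → b ∈ σ → Linked (λ x y → y ≡ suc x) b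
  consecutive {[]}         _  = []
  consecutive {_ ∷ []}     _  = [-]
  consecutive {x ∷ y ∷ []} b∈ with y ≟ suc x
  ... | yes y≡x+1 = y≡x+1 ∷ [-]
  ... | no  y≢x+1 = ⊥-elim (avoids (gap-block⇒contains-13/2 p b∈ x+1<y))
    where x+1<y = ≤∧≢⇒< (Linked.head (All.lookup sorted b∈)) (y≢x+1 ∘ sym)
  consecutive {_ ∷ _ ∷ _ ∷ _} b∈ with s≤s (s≤s ()) ← All.lookup matching b∈

avoiders⇔ : ∀ n σ → InΠ n (p13/2 ∷ p123 ∷ []) σ ⇔ (IsSetPartition n σ × Layered σ × Matching σ)
avoiders⇔ n σ = mk⇔ to from
  where
  to : InΠ n (p13/2 ∷ p123 ∷ []) σ → IsSetPartition n σ × Layered σ × Matching σ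
  to (p , avoids-13/2 ∷ avoids-123 ∷ []) = p , avoids-13/2⇒layered p matching avoids-13/2 , matching
    where matching = avoids-123⇒matching p avoids-123
  ¬apart-13/2 : ¬ PairwiseApart ((1 ∷ 3 ∷ []) ∷ (2 ∷ []) ∷ [])
  ¬apart-13/2 (((¬2⊏13 , _) ∷ []) ∷ _) =
    ¬2⊏13 (1 , 2 , 3 , here refl , here refl , there (here refl) , ≤-refl , ≤-refl)
  ¬matching-123 : ¬ Matching ((1 ∷ 2 ∷ 3 ∷ []) ∷ [])
  ¬matching-123 (s≤s (s≤s ()) ∷ [])
  from : IsSetPartition n σ × Layered σ × Matching σ → InΠ n (p13/2 ∷ p123 ∷ []) σ
  from plm@(p , _ , matching) =
    p , pairwiseApart⇒avoids apart ¬apart-13/2 ∷ matching⇒avoids matching ¬matching-123 ∷ []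
    where apart = layeredMatching⇒pairwiseApart (Equivalence.from (layeredMatching⇔ n σ) plm)

proposition2p10 : (n : ℕ) →
    ((σ : Blocks) → InΠ n (p13/2 ∷ p123 ∷ []) σ ⇔ (IsSetPartition n σ × Layered σ × Matching σ))
    × HasCard (InΠ n (p13/2 ∷ p123 ∷ [])) (F n)
proposition2p10 n =
  avoiders⇔ n ,
  layeredMatchings 1 n ,
  layeredMatchings-unique 1 n ,
  (λ σ → ⇔-trans (∈-layeredMatchings 1 n) (⇔-trans (layeredMatching⇔ n σ) (⇔-sym (avoiders⇔ n σ)))) ,
  length-layeredMatchings 1 n
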